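{- Let $n,m$ be integers with $n\ge 2$ and $0\le m\le n-1$. Suppose $B^\ast$ is a bipartite graph with $n$ vertices and $m$ edges such that $\sigma_2(B^\ast)$ attains the maximum value of $\sigma_2$ among all bipartite graphs with $n$ vertices and $m$ edges. Then $B^\ast\cong K_{1,m}\cup S_{n-m-1}$, i.e. $B^\ast$ is the star with $m$ edges together with $n-m-1$ isolated vertices.
   Context: All graphs are finite, simple and undirected. For a graph $G$, $\sigma_2(G)=\sum_{v\in V(G)} d(v)^2$, where $d(v)$ is the degree of $v$. $S_t$ denotes the edgeless graph on $t$ vertices, and $\cup$ denotes disjoint union. -}

module Defs where

open import Data.Nat using (ℕ; zero; suc; _+_; _*_; _<_; _≤_; _<ᵇ_)
open import Data.Bool using (Bool; true; false; if_then_else_; _∧_; _∨_; not)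
open import Data.Fin using (Fin; toℕ)
open import Data.List using (List; map)
open import Data.Nat.ListAction using (sum)
open import Data.List using () renaming (allFin to allFinL)
open import Data.Product using (Σ; _×_; _,_)
open import Relation.Binary.PropositionalEquality using (_≡_; _≢_; refl)
open import Function.Bundles using (_↔_; Inverse)
open import Data.Bool using (T)

record Graph (n : ℕ) : Set where
  field
    adj   : Fin n → Fin n → Bool
    sym   : ∀ u v → adj u v ≡ adj v u
    irrefl : ∀ v → adj v v ≡ false
open Graph public

count : {n : ℕ} → (Fin n → Bool) → ℕ
count {n} f = sum (map (λ i → if f i then 1 else 0) (allFinL n))

deg : {n : ℕ} → Graph n → Fin n → ℕ
deg G v = count (adj G v)

edges : {n : ℕ} → Graph n → ℕ
edges {n} G = sum (map (λ u → count (λ v → (toℕ u <ᵇ toℕ v) ∧ adj G u v)) (allFinL n))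

σ₂ : {n : ℕ} → Graph n → ℕ
σ₂ {n} G = sum (map (λ v → deg G v * deg G v) (allFinL n))

Bipartite : {n : ℕ} → Graph n → Set
Bipartite {n} G = Σ (Fin n → Bool) λ c → ∀ u v → T (adj G u v) → c u ≢ c v

_≅_ : {n : ℕ} → Graph n → Graph n → Set
_≅_ {n} G H = Σ (Fin n ↔ Fin n) λ f → ∀ u v → adj G u v ≡ adj H (Inverse.to f u) (Inverse.to f v)

private
  isZ : ℕ → Bool
  isZ zero = true
  isZ (suc _) = false

  lf : (n m : ℕ) → Fin n → Fin n → Bool
  lf n m a b = isZ (toℕ a) ∧ ((0 <ᵇ toℕ b) ∧ (toℕ b <ᵇ suc m))

  ∨-comm : ∀ x y → (x ∨ y) ≡ (y ∨ x)
  ∨-comm false false = refl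
  ∨-comm false true = refl
  ∨-comm true false = refl
  ∨-comm true true = refl

  lf-irr : ∀ n m (v : Fin n) → lf n m v v ≡ false
  lf-irr n m v with toℕ v
  ... | zero = refl
  ... | suc _ = refl

  ∨ff : ∀ x → x ≡ false → (x ∨ x) ≡ false
  ∨ff .false refl = refl

star∪S : (n m : ℕ) → Graph n
star∪S n m = record
  { adj = λ u v → lf n m u v ∨ lf n m v u
  ; sym = λ u v → ∨-comm (lf n m u v) (lf n m v u)
  ; irrefl = λ v → ∨ff (lf n m v v) (lf-irr n m v)
  }

-- A bipartite graph has no triangles, so the two ends u, v of an edge have
-- disjoint neighbourhoods, and counting degrees gives d(u) + d(v) ≤ e + 1 for a
-- graph with e edges. As σ₂ = Σ_{uv ∈ E} (d(u) + d(v)), this yields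
-- σ₂ ≤ e(e + 1), the value of the star K_{1,e}. In a maximiser every edge is
-- therefore tight, d(u) + d(v) = e + 1; every vertex off a tight edge then has
-- degree at most 1, which produces a vertex of degree e, and a vertex of degree e
-- meets every edge, so the graph is a star plus isolated vertices.
module Submission where

open import Defs renaming (sym to adj-comm)
open import Data.Bool using (Bool; true; false; if_then_else_; _∧_; _∨_; T)
open import Data.Bool.Properties using (∧-zeroʳ; ∨-identityʳ; ¬-not)
import Data.Bool.Properties as Bool
open import Data.Empty using (⊥; ⊥-elim)
open import Data.Fin using (Fin; zero; suc; toℕ; fromℕ<; punchIn)
open import Data.Fin.Permutation
  using (Permutation′; _⟨$⟩ʳ_; _⟨$⟩ˡ_; lift₀; insert; transpose; _∘ₚ_)
import Data.Fin.Permutation as Permutation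
open import Data.Fin.Properties using (_≟_; toℕ-fromℕ<; toℕ-injective; any?)
open import Data.List using (tabulate; map; allFin)
open import Data.List.Properties using (map-tabulate)
open import Data.Nat using (ℕ; zero; suc; _+_; _*_; _≤_; _<_; _<ᵇ_; _<?_; _≤?_; z≤n; s≤s)
import Data.Nat.ListAction as List
open import Data.Nat.Properties
  using ( ≤-refl; ≤-trans; ≤-antisym; ≤-reflexive; ≤-pred; <⇒≱; ≰⇒>; ≮⇒≥; n≮n; n≤0⇒n≡0
        ; <-cmp; suc-injective; m≤m+n; m≤n+m; +-comm; +-assoc; +-identityʳ
        ; +-mono-≤; +-mono-<; +-monoˡ-≤; +-monoʳ-≤; +-cancelˡ-≤; +-cancelʳ-≤
        ; *-suc; *-distribˡ-+; *-distribʳ-+; *-monoʳ-≤; *-cancelˡ-≡; +-*-semiring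
        ; module ≤-Reasoning )
open import Algebra.Properties.Semiring.Sum +-*-semiring
  using (sum; sum-syntax; sum-cong-≗; ∑-distrib-+; ∑-comm; *-distribʳ-sum; sum-replicate-zero)
open import Data.Nat.Tactic.RingSolver using (solve-∀)
open import Data.Product using (Σ; ∃-syntax; _×_; _,_; proj₁; proj₂)
open import Data.Sum using (_⊎_; inj₁; inj₂; [_,_]′)
open import Function using (id; _∘_)
open import Relation.Binary.Definitions using (tri<; tri≈; tri>)
open import Relation.Binary.PropositionalEquality
  using (_≡_; _≢_; refl; sym; trans; cong; cong₂; subst; subst₂; module ≡-Reasoning)
open import Relation.Nullary using (¬_; yes; no; does; contradiction)
open import Relation.Nullary.Decidable using (dec-true; dec-false; ¬?; _×-dec_)

⟦_⟧ : Bool → ℕ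
⟦ b ⟧ = if b then 1 else 0

⟦⟧≤1 : ∀ b → ⟦ b ⟧ ≤ 1
⟦⟧≤1 false = z≤n
⟦⟧≤1 true  = ≤-refl

⟦⟧*⟦⟧ : ∀ b → ⟦ b ⟧ * ⟦ b ⟧ ≡ ⟦ b ⟧
⟦⟧*⟦⟧ false = refl
⟦⟧*⟦⟧ true  = refl

0<⟦⟧⇒≡true : ∀ {b} → 0 < ⟦ b ⟧ → b ≡ true
0<⟦⟧⇒≡true {true} _ = refl

m+m≤n+n⇒m≤n : ∀ {m n} → m + m ≤ n + n → m ≤ n
m+m≤n+n⇒m≤n {m} {n} m+m≤n+n with m ≤? n
... | yes m≤n = m≤n
... | no  m≰n = contradiction m+m≤n+n (<⇒≱ (+-mono-< (≰⇒> m≰n) (≰⇒> m≰n)))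

m+m≡n+n⇒m≡n : ∀ {m n} → m + m ≡ n + n → m ≡ n
m+m≡n+n⇒m≡n eq = ≤-antisym (m+m≤n+n⇒m≤n (≤-reflexive eq)) (m+m≤n+n⇒m≤n (≤-reflexive (sym eq)))

sum-tabulate : ∀ {n} (f : Fin n → ℕ) → List.sum (tabulate f) ≡ sum f
sum-tabulate {zero}  f = refl
sum-tabulate {suc n} f = cong (f zero +_) (sum-tabulate (f ∘ suc))

sum-allFin : ∀ {n} (f : Fin n → ℕ) → List.sum (map f (allFin n)) ≡ sum f
sum-allFin {n} f = trans (cong List.sum (map-tabulate id f)) (sum-tabulate f)

∑-distrib-+₃ : ∀ {n} (f g h : Fin n → ℕ) →
               ∑[ i < n ] (f i + g i + h i) ≡ sum f + sum g + sum h
∑-distrib-+₃ f g h = trans (∑-distrib-+ _ h) (cong (_+ sum h) (∑-distrib-+ f g))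

sum-mono-≤ : ∀ {n} {f g : Fin n → ℕ} → (∀ i → f i ≤ g i) → sum f ≤ sum g
sum-mono-≤ {zero}  f≤g = z≤n
sum-mono-≤ {suc n} f≤g = +-mono-≤ (f≤g zero) (sum-mono-≤ (f≤g ∘ suc))

term≤sum : ∀ {n} (f : Fin n → ℕ) i → f i ≤ sum f
term≤sum f zero    = m≤m+n (f zero) _
term≤sum f (suc i) = ≤-trans (term≤sum (f ∘ suc) i) (m≤n+m _ (f zero))

pointwise≤∧sum≥⇒≗ : ∀ {n} {f g : Fin n → ℕ} →
                    (∀ i → f i ≤ g i) → sum g ≤ sum f → ∀ i → f i ≡ g i
pointwise≤∧sum≥⇒≗ {suc n} {f} {g} f≤g Σg≤Σf zero    = ≤-antisym (f≤g zero) g₀≤f₀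
  where
  g₀≤f₀ : g zero ≤ f zero
  g₀≤f₀ = +-cancelʳ-≤ (sum (g ∘ suc)) _ _
            (≤-trans Σg≤Σf (+-monoʳ-≤ (f zero) (sum-mono-≤ (f≤g ∘ suc))))
pointwise≤∧sum≥⇒≗ {suc n} {f} {g} f≤g Σg≤Σf (suc i) =
  pointwise≤∧sum≥⇒≗ (f≤g ∘ suc) Σg′≤Σf′ i
  where
  Σg′≤Σf′ : sum (g ∘ suc) ≤ sum (f ∘ suc)
  Σg′≤Σf′ = +-cancelˡ-≤ (g zero) _ _ (≤-trans Σg≤Σf (+-monoˡ-≤ _ (f≤g zero)))

0<sum⇒∃0< : ∀ {n} (f : Fin n → ℕ) → 0 < sum f → ∃[ i ] 0 < f i
0<sum⇒∃0< {suc n} f 0<Σf with f zero in f₀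
... | suc _ = zero , subst (0 <_) (sym f₀) (s≤s z≤n)
... | zero  with i , 0<fi ← 0<sum⇒∃0< (f ∘ suc) 0<Σf = suc i , 0<fi

δ : ∀ {n} → Fin n → ℕ → Fin n → ℕ
δ u a x = if does (x ≟ u) then a else 0

δ-≢ : ∀ {n} {u x : Fin n} {a} → x ≢ u → δ u a x ≡ 0
δ-≢ {u = u} {x} x≢u rewrite dec-false (x ≟ u) x≢u = refl

sum-δ : ∀ {n} (u : Fin n) a → sum (δ u a) ≡ a
sum-δ {suc n} zero    a = trans (cong (a +_) (sum-replicate-zero n)) (+-identityʳ a)
sum-δ {suc n} (suc u) a = sum-δ u a

sum≤term⇒others≡0 : ∀ {n} (f : Fin n → ℕ) {c} → sum f ≤ f c → ∀ {w} → w ≢ c → f w ≡ 0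
sum≤term⇒others≡0 f {c} Σf≤fc {w} w≢c =
  trans (sym (pointwise≤∧sum≥⇒≗ δ≤f Σf≤Σδ w)) (δ-≢ w≢c)
  where
  δ≤f : ∀ x → δ c (f c) x ≤ f x
  δ≤f x with x ≟ c
  ... | yes refl = ≤-refl
  ... | no  _    = z≤n
  Σf≤Σδ : sum f ≤ sum (δ c (f c))
  Σf≤Σδ = subst (sum f ≤_) (sym (sum-δ c (f c))) Σf≤fc

count≤ : ∀ {n} (P : Fin n → Bool) → ∑[ i < n ] ⟦ P i ⟧ ≤ n
count≤ {zero}  P = z≤n
count≤ {suc n} P = +-mono-≤ (⟦⟧≤1 (P zero)) (count≤ (P ∘ suc))

count-<ᵇ : ∀ {k m} → m ≤ k → ∑[ i < k ] ⟦ toℕ i <ᵇ m ⟧ ≡ m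
count-<ᵇ {k} {zero}  _          = sum-replicate-zero k
count-<ᵇ {suc k} {suc m} (s≤s m≤k) = cong suc (count-<ᵇ m≤k)

<ᵇ-true : ∀ {a b} → a < b → (a <ᵇ b) ≡ true
<ᵇ-true {a} {b} = dec-true (a <? b)

<ᵇ-false : ∀ {a b} → ¬ a < b → (a <ᵇ b) ≡ false
<ᵇ-false {a} {b} = dec-false (a <? b)

⟦⟧-split-<ᵇ : ∀ a b x → (a ≡ b → x ≡ false) →
              ⟦ x ⟧ ≡ ⟦ (a <ᵇ b) ∧ x ⟧ + ⟦ (b <ᵇ a) ∧ x ⟧
⟦⟧-split-<ᵇ a b false _ rewrite ∧-zeroʳ (a <ᵇ b) | ∧-zeroʳ (b <ᵇ a) = refl
⟦⟧-split-<ᵇ a b true a≡b⇒false with <-cmp a b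
... | tri< a<b _ b≮a rewrite <ᵇ-true a<b | <ᵇ-false b≮a = refl
... | tri≈ _ a≡b _   = contradiction (a≡b⇒false a≡b) λ ()
... | tri> a≮b _ b<a rewrite <ᵇ-false a≮b | <ᵇ-true b<a = refl

module _ {n} (G : Graph n) where

  deg≡sum : ∀ v → deg G v ≡ ∑[ u < n ] ⟦ adj G v u ⟧
  deg≡sum v = sum-allFin {n} _

  edges≡sum : edges G ≡ ∑[ u < n ] ∑[ v < n ] ⟦ (toℕ u <ᵇ toℕ v) ∧ adj G u v ⟧
  edges≡sum = trans (sum-allFin {n} _) (sum-cong-≗ {n} λ u → sum-allFin {n} _)

  σ₂≡sum : σ₂ G ≡ ∑[ v < n ] (deg G v * deg G v)
  σ₂≡sum = sum-allFin {n} _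

  adj≤deg : ∀ u v → ⟦ adj G u v ⟧ ≤ deg G u
  adj≤deg u v = subst (_ ≤_) (sym (deg≡sum u)) (term≤sum {n} _ v)

  adj⇒1≤deg : ∀ {u v} → adj G u v ≡ true → 1 ≤ deg G u
  adj⇒1≤deg {u} {v} uv = subst (λ b → ⟦ b ⟧ ≤ deg G u) uv (adj≤deg u v)

  adj-sym : ∀ {u v} → adj G u v ≡ true → adj G v u ≡ true
  adj-sym {u} {v} uv = trans (adj-comm G v u) uv

  adj⇒≢ : ∀ {u v} → adj G u v ≡ true → u ≢ v
  adj⇒≢ {u} uv refl = contradiction (trans (sym uv) (irrefl G u)) λ ()

  handshake : sum (deg G) ≡ edges G + edges G
  handshake = begin
    sum (deg G)
      ≡⟨ sum-cong-≗ {n} deg≡sum ⟩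
    ∑[ u < n ] ∑[ v < n ] ⟦ adj G u v ⟧
      ≡⟨ sum-cong-≗ {n} (sum-cong-≗ {n} ∘ split) ⟩
    ∑[ u < n ] ∑[ v < n ] (forward u v + backward u v)
      ≡⟨ sum-cong-≗ {n} (λ u → ∑-distrib-+ {n} _ _) ⟩
    ∑[ u < n ] (∑[ v < n ] forward u v + ∑[ v < n ] backward u v)
      ≡⟨ ∑-distrib-+ {n} _ _ ⟩
    Σforward + ∑[ u < n ] ∑[ v < n ] backward u v
      ≡⟨ cong (Σforward +_) (∑-comm {n} {n} backward) ⟩
    Σforward + ∑[ v < n ] ∑[ u < n ] backward u v
      ≡⟨ cong (Σforward +_) (sum-cong-≗ {n} λ v → sum-cong-≗ {n} λ u → backward≡forward v u) ⟩
    Σforward + Σforward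
      ≡⟨ cong₂ _+_ (sym edges≡sum) (sym edges≡sum) ⟩
    edges G + edges G ∎
    where
    open ≡-Reasoning
    forward backward : Fin n → Fin n → ℕ
    forward  u v = ⟦ (toℕ u <ᵇ toℕ v) ∧ adj G u v ⟧
    backward u v = ⟦ (toℕ v <ᵇ toℕ u) ∧ adj G u v ⟧
    Σforward : ℕ
    Σforward = ∑[ u < n ] ∑[ v < n ] forward u v
    split : ∀ u v → ⟦ adj G u v ⟧ ≡ forward u v + backward u v
    split u v = ⟦⟧-split-<ᵇ (toℕ u) (toℕ v) (adj G u v) λ u≡v →
                  subst (λ w → adj G u w ≡ false) (toℕ-injective u≡v) (irrefl G u)
    backward≡forward : ∀ v u → backward u v ≡ forward v u
    backward≡forward v u = cong (λ b → ⟦ (toℕ v <ᵇ toℕ u) ∧ b ⟧) (adj-comm G u v)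

  deg*≡∑ : ∀ v c → deg G v * c ≡ ∑[ u < n ] (⟦ adj G v u ⟧ * c)
  deg*≡∑ v c = trans (cong (_* c) (deg≡sum v)) (*-distribʳ-sum {n} c _)

  ∑∑adj*≡ : ∀ c → ∑[ v < n ] ∑[ u < n ] (⟦ adj G v u ⟧ * c) ≡ (edges G + edges G) * c
  ∑∑adj*≡ c = begin
    ∑[ v < n ] ∑[ u < n ] (⟦ adj G v u ⟧ * c) ≡⟨ sum-cong-≗ {n} (λ v → deg*≡∑ v c) ⟨
    ∑[ v < n ] (deg G v * c)                   ≡⟨ sym (*-distribʳ-sum c (deg G)) ⟩
    sum (deg G) * c                            ≡⟨ cong (_* c) handshake ⟩
    (edges G + edges G) * c                    ∎
    where open ≡-Reasoning

  σ₂+σ₂≡∑∑adj*deg+deg :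
    σ₂ G + σ₂ G ≡ ∑[ v < n ] ∑[ u < n ] (⟦ adj G v u ⟧ * (deg G v + deg G u))
  σ₂+σ₂≡∑∑adj*deg+deg = begin
    σ₂ G + σ₂ G
      ≡⟨ cong₂ _+_ σ₂≡∑∑own σ₂≡∑∑other ⟩
    ∑[ v < n ] ∑[ u < n ] own v u + ∑[ v < n ] ∑[ u < n ] other v u
      ≡⟨ ∑-distrib-+ {n} _ _ ⟨
    ∑[ v < n ] (∑[ u < n ] own v u + ∑[ u < n ] other v u)
      ≡⟨ sum-cong-≗ {n} (λ v → ∑-distrib-+ {n} _ _) ⟨
    ∑[ v < n ] ∑[ u < n ] (own v u + other v u)
      ≡⟨ sum-cong-≗ {n} (λ v → sum-cong-≗ {n} λ u → *-distribˡ-+ ⟦ adj G v u ⟧ (deg G v) (deg G u)) ⟨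
    ∑[ v < n ] ∑[ u < n ] (⟦ adj G v u ⟧ * (deg G v + deg G u)) ∎
    where
    open ≡-Reasoning
    own other : Fin n → Fin n → ℕ
    own   v u = ⟦ adj G v u ⟧ * deg G v
    other v u = ⟦ adj G v u ⟧ * deg G u
    σ₂≡∑∑own : σ₂ G ≡ ∑[ v < n ] ∑[ u < n ] own v u
    σ₂≡∑∑own = trans σ₂≡sum (sum-cong-≗ {n} λ v → deg*≡∑ v (deg G v))
    σ₂≡∑∑other : σ₂ G ≡ ∑[ v < n ] ∑[ u < n ] other v u
    σ₂≡∑∑other = trans σ₂≡∑∑own (trans (∑-comm {n} {n} own)
                   (sum-cong-≗ {n} λ v → sum-cong-≗ {n} λ u → cong (λ b → ⟦ b ⟧ * deg G u) (adj-comm G u v)))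

  edge-exists : 0 < edges G → ∃[ u ] ∃[ v ] adj G u v ≡ true
  edge-exists 0<e with u , 0<deg-u ← 0<sum⇒∃0< (deg G) (subst (0 <_) (sym handshake) (+-mono-< 0<e 0<e))
                   with v , 0<uv   ← 0<sum⇒∃0< {n} _ (subst (0 <_) (deg≡sum u) 0<deg-u)
                   = u , v , 0<⟦⟧⇒≡true 0<uv

  other-neighbour : ∀ {u} v → ¬ deg G u ≤ 1 → ∃[ w ] w ≢ v × adj G u w ≡ true
  other-neighbour {u} v deg≰1 with any? (λ w → ¬? (w ≟ v) ×-dec (adj G u w Bool.≟ true))
  ... | yes found = found
  ... | no  none  = contradiction deg≤1 deg≰1
    where
    adj≤δ : ∀ w → ⟦ adj G u w ⟧ ≤ δ v 1 w
    adj≤δ w with w ≟ v | adj G u w in uw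
    ... | yes _   | b     = ⟦⟧≤1 b
    ... | no  w≢v | true  = contradiction (w , w≢v , uw) none
    ... | no  _   | false = z≤n
    deg≤1 : deg G u ≤ 1
    deg≤1 = subst₂ _≤_ (sym (deg≡sum u)) (sum-δ v 1) (sum-mono-≤ adj≤δ)

  deg≡edges⇒covers : ∀ {c} → deg G c ≡ edges G →
                     ∀ {x y} → adj G x y ≡ true → x ≡ c ⊎ y ≡ c
  deg≡edges⇒covers {c} deg-c {x} {y} xy with x ≟ c | y ≟ c
  ... | yes x≡c | _       = inj₁ x≡c
  ... | no  _   | yes y≡c = inj₂ y≡c
  ... | no  x≢c | no  y≢c =
    contradiction (trans (sym (cong ⟦_⟧ xy)) (sum≤term⇒others≡0 {n} _ Σ≤adj-xc y≢c)) λ ()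
    where
    star≤deg : ∀ w → δ c (edges G) w + ⟦ adj G c w ⟧ ≤ deg G w
    star≤deg w with w ≟ c
    ... | yes refl rewrite irrefl G w = ≤-reflexive (trans (+-identityʳ _) (sym deg-c))
    ... | no  _    = subst (_≤ deg G w) (cong ⟦_⟧ (adj-comm G w c)) (adj≤deg w c)
    Σdeg≤Σstar : sum (deg G) ≤ ∑[ w < n ] (δ c (edges G) w + ⟦ adj G c w ⟧)
    Σdeg≤Σstar = ≤-reflexive (begin
      sum (deg G)
        ≡⟨ handshake ⟩
      edges G + edges G
        ≡⟨ cong₂ _+_ (sym (sum-δ c _)) (trans (sym deg-c) (deg≡sum c)) ⟩
      sum (δ c (edges G)) + ∑[ w < n ] ⟦ adj G c w ⟧
        ≡⟨ ∑-distrib-+ {n} _ _ ⟨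
      ∑[ w < n ] (δ c (edges G) w + ⟦ adj G c w ⟧) ∎)
      where open ≡-Reasoning
    Σ≤adj-xc : ∑[ w < n ] ⟦ adj G x w ⟧ ≤ ⟦ adj G x c ⟧
    Σ≤adj-xc = ≤-reflexive (begin
      ∑[ w < n ] ⟦ adj G x w ⟧                   ≡⟨ sym (deg≡sum x) ⟩
      deg G x                                    ≡⟨ sym (pointwise≤∧sum≥⇒≗ star≤deg Σdeg≤Σstar x) ⟩
      δ c (edges G) x + ⟦ adj G c x ⟧            ≡⟨ cong₂ (λ a b → a + ⟦ b ⟧) (δ-≢ x≢c) (adj-comm G c x) ⟩
      ⟦ adj G x c ⟧                              ∎)
      where open ≡-Reasoning

TriangleFree : ∀ {n} → Graph n → Set
TriangleFree G = ∀ {u v w} → adj G u v ≡ true → adj G v w ≡ true → adj G u w ≡ true → ⊥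

bipartite⇒triangleFree : ∀ {n} (G : Graph n) → Bipartite G → TriangleFree G
bipartite⇒triangleFree G (colour , proper) {u} {v} {w} uv vw uw =
  proper u w (properly uw)
    (trans (¬-not (proper u v (properly uv))) (sym (¬-not (proper w v (properly (adj-sym G vw))))))
  where
  properly : ∀ {x y} → adj G x y ≡ true → T (adj G x y)
  properly xy = subst T (sym xy) _

module _ {n} (G : Graph n) (triangleFree : TriangleFree G) {u v} (uv : adj G u v ≡ true) where

  private
    nbrs : Fin n → ℕ
    nbrs x = ⟦ adj G u x ⟧ + ⟦ adj G v x ⟧

    nbrs≤1 : ∀ x → nbrs x ≤ 1
    nbrs≤1 x with adj G u x in ux | adj G v x in vx
    ... | true  | true  = ⊥-elim (triangleFree (adj-sym G uv) ux vx)
    ... | true  | false = ≤-refl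
    ... | false | b     = ⟦⟧≤1 b

    nbrs≤deg : ∀ x → nbrs x ≤ deg G x
    nbrs≤deg x with adj G u x in ux | adj G v x in vx
    ... | true  | true  = ⊥-elim (triangleFree (adj-sym G uv) ux vx)
    ... | true  | false = adj⇒1≤deg G (adj-sym G ux)
    ... | false | true  = adj⇒1≤deg G (adj-sym G vx)
    ... | false | false = z≤n

    -- Summing `lower ≤ upper` counts d(u) + d(v) twice on the left; the 1s on the
    -- right account for nbrs u = nbrs v = 1.
    lower upper : Fin n → ℕ
    lower x = nbrs x + δ u (deg G u) x + δ v (deg G v) x
    upper x = deg G x + δ u 1 x + δ v 1 x

    lower≤upper : ∀ x → lower x ≤ upper x
    lower≤upper x with x ≟ u | x ≟ v
    ... | yes refl | yes refl = contradiction refl (adj⇒≢ G uv)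
    ... | yes refl | no  _    rewrite irrefl G x | adj-sym G uv =
      ≤-reflexive (cong (_+ 0) (+-comm 1 (deg G x)))
    ... | no  _    | yes refl rewrite irrefl G x | uv =
      ≤-reflexive (trans (+-comm 1 (deg G x)) (cong (_+ 1) (sym (+-identityʳ (deg G x)))))
    ... | no  _    | no  _    = +-monoˡ-≤ 0 (+-monoˡ-≤ 0 (nbrs≤deg x))

    Σlower : sum lower ≡ (deg G u + deg G v) + (deg G u + deg G v)
    Σlower = begin
      sum lower
        ≡⟨ ∑-distrib-+₃ nbrs (δ u (deg G u)) (δ v (deg G v)) ⟩
      sum nbrs + sum (δ u (deg G u)) + sum (δ v (deg G v))
        ≡⟨ cong₂ _+_ (cong₂ _+_ Σnbrs (sum-δ u _)) (sum-δ v _) ⟩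
      (deg G u + deg G v) + deg G u + deg G v
        ≡⟨ +-assoc (deg G u + deg G v) _ _ ⟩
      (deg G u + deg G v) + (deg G u + deg G v) ∎
      where
      open ≡-Reasoning
      Σnbrs : sum nbrs ≡ deg G u + deg G v
      Σnbrs = trans (∑-distrib-+ {n} _ _) (sym (cong₂ _+_ (deg≡sum G u) (deg≡sum G v)))

    Σupper : sum upper ≡ suc (edges G) + suc (edges G)
    Σupper = begin
      sum upper
        ≡⟨ ∑-distrib-+₃ (deg G) (δ u 1) (δ v 1) ⟩
      sum (deg G) + sum (δ u 1) + sum (δ v 1)
        ≡⟨ cong₂ _+_ (cong₂ _+_ (handshake G) (sum-δ u 1)) (sum-δ v 1) ⟩
      edges G + edges G + 1 + 1
        ≡⟨ e+e+1+1 (edges G) ⟩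
      suc (edges G) + suc (edges G) ∎
      where
      open ≡-Reasoning
      e+e+1+1 : ∀ e → e + e + 1 + 1 ≡ suc e + suc e
      e+e+1+1 = solve-∀

  deg+deg≤suc-edges : deg G u + deg G v ≤ suc (edges G)
  deg+deg≤suc-edges =
    m+m≤n+n⇒m≤n (subst₂ _≤_ Σlower Σupper (sum-mono-≤ lower≤upper))

  tight-edge⇒deg≤1 : deg G u + deg G v ≡ suc (edges G) → ∀ {x} → x ≢ u → x ≢ v → deg G x ≤ 1
  tight-edge⇒deg≤1 tight {x} x≢u x≢v = begin
    deg G x           ≡⟨ sym (trans (+-identityʳ _) (+-identityʳ _)) ⟩
    deg G x + 0 + 0   ≡⟨ cong₂ (λ a b → deg G x + a + b) (sym (δ-≢ x≢u)) (sym (δ-≢ x≢v)) ⟩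
    upper x           ≡⟨ sym (pointwise≤∧sum≥⇒≗ lower≤upper Σupper≤Σlower x) ⟩
    lower x           ≡⟨ cong₂ (λ a b → nbrs x + a + b) (δ-≢ x≢u) (δ-≢ x≢v) ⟩
    nbrs x + 0 + 0    ≡⟨ trans (+-identityʳ _) (+-identityʳ _) ⟩
    nbrs x            ≤⟨ nbrs≤1 x ⟩
    1                 ∎
    where
    open ≤-Reasoning
    Σupper≤Σlower : sum upper ≤ sum lower
    Σupper≤Σlower = ≤-reflexive (trans Σupper (trans (cong (λ s → s + s) (sym tight)) (sym Σlower)))

AllEdgesTight : ∀ {n} → Graph n → Set
AllEdgesTight G = ∀ {u v} → adj G u v ≡ true → deg G u + deg G v ≡ suc (edges G)

module _ {n} (G : Graph n) (triangleFree : TriangleFree G) where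

  private
    edge-term≤ : ∀ v u → ⟦ adj G v u ⟧ * (deg G v + deg G u) ≤ ⟦ adj G v u ⟧ * suc (edges G)
    edge-term≤ v u with adj G v u in vu
    ... | true  = *-monoʳ-≤ 1 (deg+deg≤suc-edges G triangleFree vu)
    ... | false = z≤n

  -- Summing `edge-term≤` over ordered pairs gives 2σ₂ ≤ 2e(e + 1); if σ₂ ≥ e(e + 1),
  -- every one of these inequalities is an equality.
  σ₂≥⇒allEdgesTight : edges G * suc (edges G) ≤ σ₂ G → AllEdgesTight G
  σ₂≥⇒allEdgesTight e*suc-e≤σ₂ {v} {u} vu =
    *-cancelˡ-≡ _ _ 1 (subst (λ b → ⟦ b ⟧ * (deg G v + deg G u) ≡ ⟦ b ⟧ * suc (edges G)) vu entry)
    where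
    Σbound≤Σterms : ∑[ v < n ] ∑[ u < n ] (⟦ adj G v u ⟧ * suc (edges G))
                  ≤ ∑[ v < n ] ∑[ u < n ] (⟦ adj G v u ⟧ * (deg G v + deg G u))
    Σbound≤Σterms = begin
      ∑[ v < n ] ∑[ u < n ] (⟦ adj G v u ⟧ * suc (edges G))
        ≡⟨ ∑∑adj*≡ G (suc (edges G)) ⟩
      (edges G + edges G) * suc (edges G)
        ≡⟨ *-distribʳ-+ (suc (edges G)) (edges G) (edges G) ⟩
      edges G * suc (edges G) + edges G * suc (edges G)
        ≤⟨ +-mono-≤ e*suc-e≤σ₂ e*suc-e≤σ₂ ⟩
      σ₂ G + σ₂ G
        ≡⟨ σ₂+σ₂≡∑∑adj*deg+deg G ⟩
      ∑[ v < n ] ∑[ u < n ] (⟦ adj G v u ⟧ * (deg G v + deg G u)) ∎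
      where open ≤-Reasoning
    row : ∑[ u < n ] (⟦ adj G v u ⟧ * (deg G v + deg G u))
        ≡ ∑[ u < n ] (⟦ adj G v u ⟧ * suc (edges G))
    row = pointwise≤∧sum≥⇒≗ (λ v → sum-mono-≤ (edge-term≤ v)) Σbound≤Σterms v
    entry : ⟦ adj G v u ⟧ * (deg G v + deg G u) ≡ ⟦ adj G v u ⟧ * suc (edges G)
    entry = pointwise≤∧sum≥⇒≗ (edge-term≤ v) (≤-reflexive (sym row)) u

module _ {n} (G : Graph n) (triangleFree : TriangleFree G) (tight : AllEdgesTight G) where

  tight-edge⇒full-endpoint : ∀ {u v} → adj G u v ≡ true → deg G u ≡ edges G ⊎ deg G v ≡ edges G
  tight-edge⇒full-endpoint {u} {v} uv with deg G u ≤? 1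
  ... | yes deg-u≤1 = inj₂ (suc-injective (trans (cong (_+ deg G v) (sym deg-u≡1)) (tight uv)))
    where
    deg-u≡1 : deg G u ≡ 1
    deg-u≡1 = ≤-antisym deg-u≤1 (adj⇒1≤deg G uv)
  ... | no deg-u≰1 with w , w≢v , uw ← other-neighbour G v deg-u≰1 =
    inj₁ (suc-injective (trans (+-comm 1 (deg G u)) (trans (cong (deg G u +_) (sym deg-v≡1)) (tight uv))))
    where
    vu : adj G v u ≡ true
    vu = adj-sym G uv
    deg-v≡1 : deg G v ≡ 1
    deg-v≡1 = ≤-antisym (tight-edge⇒deg≤1 G triangleFree uw (tight uw) (adj⇒≢ G vu) (w≢v ∘ sym))
                        (adj⇒1≤deg G vu)

  -- The given vertex is only used when G has no edges.
  ∃-deg≡edges : Fin n → ∃[ c ] deg G c ≡ edges G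
  ∃-deg≡edges v₀ with 0 <? edges G
  ... | yes 0<e with u , v , uv ← edge-exists G 0<e =
    [ (u ,_) , (v ,_) ]′ (tight-edge⇒full-endpoint uv)
  ... | no  0≮e = v₀ , trans (n≤0⇒n≡0 deg-v₀≤0) (sym e≡0)
    where
    e≡0 : edges G ≡ 0
    e≡0 = n≤0⇒n≡0 (≮⇒≥ 0≮e)
    deg-v₀≤0 : deg G v₀ ≤ 0
    deg-v₀≤0 = ≤-trans (term≤sum (deg G) v₀) (≤-reflexive (trans (handshake G) (cong₂ _+_ e≡0 e≡0)))

module Star (k m : ℕ) where

  S : Graph (suc k)
  S = star∪S (suc k) m

  adj-centre : ∀ b → adj S zero (suc b) ≡ (toℕ b <ᵇ m)
  adj-centre b = ∨-identityʳ _

  bipartite : Bipartite S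
  bipartite = colour , proper
    where
    colour : Fin (suc k) → Bool
    colour zero    = true
    colour (suc _) = false
    proper : ∀ u v → T (adj S u v) → colour u ≢ colour v
    proper zero    (suc _) _ = λ ()
    proper (suc _) zero    _ = λ ()

  deg-leaf : ∀ b → deg S (suc b) ≡ ⟦ toℕ b <ᵇ m ⟧
  deg-leaf b = trans (deg≡sum S (suc b))
                     (trans (cong (⟦ toℕ b <ᵇ m ⟧ +_) (sum-replicate-zero k)) (+-identityʳ _))

  module _ (m≤k : m ≤ k) where

    deg-centre : deg S zero ≡ m
    deg-centre = trans (deg≡sum S zero)
                       (trans (sum-cong-≗ {k} (cong ⟦_⟧ ∘ adj-centre)) (count-<ᵇ m≤k))

    Σdeg-leaf : ∑[ b < k ] deg S (suc b) ≡ m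
    Σdeg-leaf = trans (sum-cong-≗ {k} deg-leaf) (count-<ᵇ m≤k)

    edges≡ : edges S ≡ m
    edges≡ = m+m≡n+n⇒m≡n (trans (sym (handshake S)) (cong₂ _+_ deg-centre Σdeg-leaf))

    σ₂≡ : σ₂ S ≡ m * suc m
    σ₂≡ = begin
      σ₂ S                                                    ≡⟨ σ₂≡sum S ⟩
      deg S zero * deg S zero + ∑[ b < k ] (deg S (suc b) * deg S (suc b))
        ≡⟨ cong₂ _+_ (cong₂ _*_ deg-centre deg-centre) (sum-cong-≗ {k} leaf²) ⟩
      m * m + ∑[ b < k ] deg S (suc b)                        ≡⟨ cong (m * m +_) Σdeg-leaf ⟩
      m * m + m                                               ≡⟨ +-comm (m * m) m ⟩
      m + m * m                                               ≡⟨ sym (*-suc m m) ⟩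
      m * suc m                                               ∎
      where
      open ≡-Reasoning
      leaf² : ∀ b → deg S (suc b) * deg S (suc b) ≡ deg S (suc b)
      leaf² b rewrite deg-leaf b = ⟦⟧*⟦⟧ (toℕ b <ᵇ m)

punchIn-<ᵇ : ∀ {n} (i : Fin (suc n)) (j : Fin n) → (toℕ (punchIn i j) <ᵇ toℕ i) ≡ (toℕ j <ᵇ toℕ i)
punchIn-<ᵇ zero    j       = refl
punchIn-<ᵇ (suc i) zero    = refl
punchIn-<ᵇ (suc i) (suc j) = punchIn-<ᵇ i j

partition-permutation : ∀ {n} (P : Fin n → Bool) →
  Σ (Permutation′ n) λ π → ∀ x → P x ≡ (toℕ (π ⟨$⟩ʳ x) <ᵇ ∑[ i < n ] ⟦ P i ⟧)
partition-permutation {zero}  P = Permutation.id , λ ()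
partition-permutation {suc n} P with partition-permutation (P ∘ suc) | P zero in P₀
... | π , sorted | true  = lift₀ π , λ { zero → P₀ ; (suc x) → sorted x }
... | π , sorted | false = insert zero K π , λ where
    zero    → trans P₀ (sym (trans (cong (_<ᵇ s) toℕ-K) (<ᵇ-false (n≮n s))))
    (suc x) → trans (sorted x) (sym (punchIn-K-<ᵇ-s (π ⟨$⟩ʳ x)))
  where
  s : ℕ
  s = ∑[ i < n ] ⟦ P (suc i) ⟧
  K : Fin (suc n)
  K = fromℕ< (s≤s (count≤ (P ∘ suc)))
  toℕ-K : toℕ K ≡ s
  toℕ-K = toℕ-fromℕ< _
  punchIn-K-<ᵇ-s : ∀ j → (toℕ (punchIn K j) <ᵇ s) ≡ (toℕ j <ᵇ s)
  punchIn-K-<ᵇ-s j = subst (λ t → (toℕ (punchIn K j) <ᵇ t) ≡ (toℕ j <ᵇ t)) toℕ-K (punchIn-<ᵇ K j)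

transpose-self : ∀ {n} (i j : Fin n) → transpose i j ⟨$⟩ʳ i ≡ j
transpose-self i j rewrite dec-true (i ≟ i) refl = refl

transpose-preserves : ∀ {n} {A : Set} (Q : Fin n → A) {i j} →
                      Q i ≡ Q j → ∀ t → Q (transpose i j ⟨$⟩ʳ t) ≡ Q t
transpose-preserves Q {i} {j} Qi≡Qj t with t ≟ i
... | yes refl = sym Qi≡Qj
... | no  _    with t ≟ j
...   | yes refl = Qi≡Qj
...   | no  _    = refl

module _ {k} (G : Graph (suc k)) {c} (covers : ∀ {x y} → adj G x y ≡ true → x ≡ c ⊎ y ≡ c) where

  private
    open Star k (deg G c) using (S; adj-centre)

    P : Fin (suc k) → Bool
    P x = does (x ≟ c) ∨ adj G c x

    ΣP≡ : ∑[ x < suc k ] ⟦ P x ⟧ ≡ suc (deg G c)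
    ΣP≡ = begin
      ∑[ x < suc k ] ⟦ P x ⟧                      ≡⟨ sum-cong-≗ {suc k} split ⟩
      ∑[ x < suc k ] (δ c 1 x + ⟦ adj G c x ⟧)    ≡⟨ ∑-distrib-+ (δ c 1) (λ x → ⟦ adj G c x ⟧) ⟩
      sum (δ c 1) + ∑[ x < suc k ] ⟦ adj G c x ⟧  ≡⟨ cong₂ _+_ (sum-δ c 1) (sym (deg≡sum G c)) ⟩
      suc (deg G c)                               ∎
      where
      open ≡-Reasoning
      split : ∀ x → ⟦ P x ⟧ ≡ δ c 1 x + ⟦ adj G c x ⟧
      split x with x ≟ c
      ... | yes refl rewrite irrefl G x = refl
      ... | no  _    = refl

    π : Permutation′ (suc k)
    π = proj₁ (partition-permutation P)

    π-sorts : ∀ x → P x ≡ (toℕ (π ⟨$⟩ʳ x) <ᵇ suc (deg G c))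
    π-sorts x = trans (proj₂ (partition-permutation P) x) (cong (toℕ (π ⟨$⟩ʳ x) <ᵇ_) ΣP≡)

    -- π puts c and its neighbours at positions 0, …, deg c; the transposition moves c to 0.
    f : Permutation′ (suc k)
    f = π ∘ₚ transpose (π ⟨$⟩ʳ c) zero

    f-centre : f ⟨$⟩ʳ c ≡ zero
    f-centre = transpose-self (π ⟨$⟩ʳ c) zero

    f-sorts : ∀ x → P x ≡ (toℕ (f ⟨$⟩ʳ x) <ᵇ suc (deg G c))
    f-sorts x = trans (π-sorts x)
      (sym (transpose-preserves (λ t → toℕ t <ᵇ suc (deg G c)) (trans (sym (π-sorts c)) P-c) (π ⟨$⟩ʳ x)))
      where
      P-c : P c ≡ true
      P-c rewrite dec-true (c ≟ c) refl = refl

    f⁻¹-centre : ∀ {x} → f ⟨$⟩ʳ x ≡ zero → x ≡ c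
    f⁻¹-centre fx = trans (sym (Permutation.inverseˡ f))
                          (trans (cong (f ⟨$⟩ˡ_) (trans fx (sym f-centre))) (Permutation.inverseˡ f))

    leaf⇒≢centre : ∀ {x b} → f ⟨$⟩ʳ x ≡ suc b → x ≢ c
    leaf⇒≢centre fx refl = contradiction (trans (sym fx) f-centre) λ ()

    adj-leaf : ∀ {v b} → f ⟨$⟩ʳ v ≡ suc b → adj G c v ≡ (toℕ b <ᵇ deg G c)
    adj-leaf {v} {b} fv = begin
      adj G c v                         ≡⟨ cong (_∨ adj G c v) (dec-false (v ≟ c) (leaf⇒≢centre fv)) ⟨
      P v                               ≡⟨ f-sorts v ⟩
      toℕ (f ⟨$⟩ʳ v) <ᵇ suc (deg G c)   ≡⟨ cong (λ t → toℕ t <ᵇ suc (deg G c)) fv ⟩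
      toℕ b <ᵇ deg G c                  ∎
      where open ≡-Reasoning

    non-edge : ∀ {x y} → x ≢ c → y ≢ c → adj G x y ≡ false
    non-edge {x} {y} x≢c y≢c with adj G x y in xy
    ... | true  = ⊥-elim ([ x≢c , y≢c ]′ (covers xy))
    ... | false = refl

  ≅star : G ≅ star∪S (suc k) (deg G c)
  ≅star = f , preserves
    where
    preserves : ∀ u v → adj G u v ≡ adj S (f ⟨$⟩ʳ u) (f ⟨$⟩ʳ v)
    preserves u v with f ⟨$⟩ʳ u in fu | f ⟨$⟩ʳ v in fv
    ... | zero  | zero  rewrite f⁻¹-centre fu | f⁻¹-centre fv = irrefl G c
    ... | zero  | suc b rewrite f⁻¹-centre fu = trans (adj-leaf fv) (sym (adj-centre b))
    ... | suc a | zero  rewrite f⁻¹-centre fv = trans (adj-comm G u c) (adj-leaf fu)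
    ... | suc a | suc b = non-edge (leaf⇒≢centre fu) (leaf⇒≢centre fv)

theorem1 : (n m : ℕ) → 2 ≤ n → m + 1 ≤ n → (B : Graph n) → Bipartite B → edges B ≡ m → ((G : Graph n) → Bipartite G → edges G ≡ m → σ₂ G ≤ σ₂ B) → B ≅ star∪S n m
theorem1 zero    _           ()  _      _ _         _    _
theorem1 (suc k) .(edges B) _   e+1≤n B bipartite refl maximal =
  let c , deg-c≡e = ∃-deg≡edges B triangleFree tight zero
  in  subst (λ m → B ≅ star∪S (suc k) m) deg-c≡e (≅star B (deg≡edges⇒covers B deg-c≡e))
  where
  open Star k (edges B) using (S; edges≡; σ₂≡) renaming (bipartite to S-bipartite)
  e≤k : edges B ≤ k
  e≤k = ≤-pred (subst (_≤ suc k) (+-comm (edges B) 1) e+1≤n)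
  triangleFree : TriangleFree B
  triangleFree = bipartite⇒triangleFree B bipartite
  tight : AllEdgesTight B
  tight = σ₂≥⇒allEdgesTight B triangleFree
            (subst (_≤ σ₂ B) (σ₂≡ e≤k) (maximal S S-bipartite (edges≡ e≤k)))
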